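{- Let $K$ be the poset of all compositions (finite sequences of positive integers, including the empty composition $\varepsilon$), ordered by $\gamma\le\kappa$ iff $\gamma_i\le\kappa_i$ for all $i$, where $\gamma_i=0$ (resp. $\kappa_i=0$) when $i$ exceeds the number of parts of $\gamma$ (resp. $\kappa$). For $\kappa\in K$ let $K(\kappa)=\{\gamma\in K:\gamma\le\kappa\}$ and $f^{K(\kappa)}(q)=\sum_{\gamma\in K(\kappa)}q^{|\gamma|}$, where $|\gamma|$ is the sum of the parts of $\gamma$. (a) If $\kappa=(\kappa_1,\ldots,\kappa_s)\ne\varepsilon$, $l=\kappa_1$ and $\gamma=(\kappa_2,\ldots,\kappa_s)$, then $f^{K(\kappa)}=1+q\,[l]\,f^{K(\gamma)}$, where $[l]=1+q+\cdots+q^{l-1}$. (b) For every composition $\kappa$, the polynomial $f^{K(\kappa)}$ is unimodal.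
   Context: A polynomial is unimodal if its coefficient sequence $a_0,\ldots,a_r$ satisfies $a_0\le\cdots\le a_m\ge a_{m+1}\ge\cdots\ge a_r$ for some index $m$. $K$ is graded by $|\gamma|$, so $f^{K(\kappa)}$ is the rank generating function of $K(\kappa)$. -}

module Defs where

open import Data.Nat using (ℕ; zero; suc; _+_; _*_; _∸_; _≤_; _<_; _⊔_; z≤n; s≤s)
open import Data.Nat.Properties using (_≤?_; _≟_)
open import Data.List using (List; []; _∷_; length; map; upTo; concatMap; filter; foldr)
open import Data.Nat.ListAction using (sum)
open import Data.List.Relation.Unary.All using (All)
open import Data.Product using (Σ; _×_; _,_)
open import Relation.Nullary using (Dec; yes; no; ¬_)
open import Relation.Binary.PropositionalEquality using (_≡_)

IsComposition : List ℕ → Set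
IsComposition κ = All (1 ≤_) κ

size : List ℕ → ℕ
size = sum

-- γ_i (0-indexed), with γ_i = 0 when i exceeds the number of parts
part : List ℕ → ℕ → ℕ
part []       i       = 0
part (x ∷ xs) zero    = x
part (x ∷ xs) (suc i) = part xs i

_≼_ : List ℕ → List ℕ → Set
γ ≼ κ = ∀ i → part γ i ≤ part κ i

_≼?_ : ∀ γ κ → Dec (γ ≼ κ)
[] ≼? κ = yes (λ i → z≤n)
(x ∷ xs) ≼? [] with x ≤? 0 | xs ≼? []
... | yes p | yes q = yes λ { zero → p ; (suc i) → q i }
... | no ¬p | _     = no λ h → ¬p (h zero)
... | yes _ | no ¬q = no λ h → ¬q (λ i → h (suc i))
(x ∷ xs) ≼? (y ∷ ys) with x ≤? y | xs ≼? ys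
... | yes p | yes q = yes λ { zero → p ; (suc i) → q i }
... | no ¬p | _     = no λ h → ¬p (h zero)
... | yes _ | no ¬q = no λ h → ¬q (λ i → h (suc i))

-- All compositions with at most L parts, each part in {1,…,M}
-- (each listed exactly once).
boundedComps : ℕ → ℕ → List (List ℕ)
boundedComps zero    M = [] ∷ []
boundedComps (suc L) M =
  [] ∷ concatMap (λ k → map (k ∷_) (boundedComps L M)) (map suc (upTo M))

maxPart : List ℕ → ℕ
maxPart = foldr _⊔_ 0

-- K(κ) = {γ ∈ K : γ ≤ κ}.  Every composition γ ≤ κ has at most
-- length κ parts, each at most maxPart κ, so it occurs in boundedComps.
Kdown : List ℕ → List (List ℕ)
Kdown κ = filter (λ γ → γ ≼? κ) (boundedComps (length κ) (maxPart κ))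

-- Polynomials in q with ℕ coefficients, as coefficient sequences
-- (coefficient of q^n at n); equality is coefficientwise.

Poly : Set
Poly = ℕ → ℕ

_≈ₚ_ : Poly → Poly → Set
f ≈ₚ g = ∀ n → f n ≡ g n

oneₚ : Poly
oneₚ zero    = 1
oneₚ (suc n) = 0

qₚ : Poly
qₚ 1 = 1
qₚ _ = 0

_+ₚ_ : Poly → Poly → Poly
(f +ₚ g) n = f n + g n

_*ₚ_ : Poly → Poly → Poly
(f *ₚ g) n = sum (map (λ i → f i * g (n ∸ i)) (upTo (suc n)))

qint : ℕ → Poly
qint l n with suc n Data.Nat.≤? l
... | yes _ = 1
... | no  _ = 0

fK : List ℕ → Poly
fK κ n = length (filter (λ γ → size γ ≟ n) (Kdown κ))

Unimodal : ℕ → Poly → Set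
Unimodal r a = Σ ℕ λ m → m ≤ r
  × (∀ i → i < m → a i ≤ a (suc i))
  × (∀ i → m ≤ i → i < r → a (suc i) ≤ a i)

-- Writing sh for
-- multiplication by q and  window l a = a + q a + ⋯ + q^{l-1} a  for [l]·a,
-- we define the candidate generating function  fRec  by the recursion
-- fRec [] = 1,  fRec (l ∷ γ) = 1 + sh (window l (fRec γ)).
--
-- A
-- composition of size n in K(l ∷ γ) is either empty (n = 0) or starts with
-- a part i + 1 with i < l and i < n followed by an element of K(γ) of size
-- n − i − 1; summing these block contributions over i gives exactly the
-- coefficient of q^n in q·[l]·fRec γ.  Hence fK ≈ fRec, and the recurrence
-- follows from  q·b = sh b  and  [l]·a = window l a  for the product *ₚ.
--
-- The first differences of window l a are a n − a (n−l).
-- For unimodal a these are ≥ 0 up to some point and ≤ 0 from there on (a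
-- bounded search finds that point), so [l]·a is unimodal; prepending the
-- constant 1 in front of q·b keeps unimodality, and induction on κ finishes.

module Submission where

open import Defs
open import Level using (0ℓ)
open import Data.Bool using (true; false)
open import Data.Nat using (ℕ; zero; suc; _+_; _*_; _∸_; _≤_; _<_; z≤n; s≤s; _≤′_; ≤′-refl; ≤′-step)
open import Data.Nat.Properties
open import Data.List using (List; []; _∷_; length; map; upTo; concatMap; filter; _++_)
open import Data.List.Properties using (length-++; filter-++; filter-≐; filter-accept; filter-reject; map-cong; map-∘; map-upTo)
open import Data.Nat.ListAction using (sum)
open import Data.List.Relation.Unary.All using (_∷_)
open import Data.Product using (Σ; ∃-syntax; _×_; _,_)
open import Data.Sum using (_⊎_; inj₁; inj₂)
open import Function using (_∘_)
open import Relation.Nullary using (Dec; does; yes; no; ¬_; contradiction; _×-dec_)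
open import Relation.Unary using (Pred; Decidable; _∩_; _≐_)
open import Relation.Unary.Properties using (_∩?_)
open import Relation.Binary.PropositionalEquality
open import Algebra.Properties.CommutativeSemigroup +-commutativeSemigroup using (xy∙z≈xz∙y)

open ≡-Reasoning

sum-upTo-suc : (f : ℕ → ℕ) (n : ℕ) →
  sum (map f (upTo (suc n))) ≡ f 0 + sum (map (f ∘ suc) (upTo n))
sum-upTo-suc f n =
  cong sum (trans (map-upTo f (suc n)) (cong (f 0 ∷_) (sym (map-upTo (f ∘ suc) n))))

sum-map-zero : {A : Set} {f : A → ℕ} → (∀ x → f x ≡ 0) → (xs : List A) → sum (map f xs) ≡ 0
sum-map-zero z []       = refl
sum-map-zero z (x ∷ xs) = cong₂ _+_ (z x) (sum-map-zero z xs)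

sh : Poly → Poly
sh a zero    = 0
sh a (suc n) = a n

sh-cong : {a b : Poly} → a ≈ₚ b → sh a ≈ₚ sh b
sh-cong e zero    = refl
sh-cong e (suc n) = e n

window : ℕ → Poly → Poly
window zero    a = λ _ → 0
window (suc l) a = a +ₚ sh (window l a)

conv-zero : (f g : Poly) → (f *ₚ g) 0 ≡ f 0 * g 0
conv-zero f g = +-identityʳ (f 0 * g 0)

conv-suc : (f g : Poly) (n : ℕ) → (f *ₚ g) (suc n) ≡ f 0 * g (suc n) + ((f ∘ suc) *ₚ g) n
conv-suc f g n = sum-upTo-suc (λ i → f i * g (suc n ∸ i)) (suc n)

conv-congˡ : {f f′ : Poly} (g : Poly) → f ≈ₚ f′ → (f *ₚ g) ≈ₚ (f′ *ₚ g)
conv-congˡ g e n = cong sum (map-cong (λ i → cong (_* g (n ∸ i)) (e i)) (upTo (suc n)))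

conv-congʳ : (f : Poly) {g g′ : Poly} → g ≈ₚ g′ → (f *ₚ g) ≈ₚ (f *ₚ g′)
conv-congʳ f e n = cong sum (map-cong (λ i → cong (f i *_) (e (n ∸ i))) (upTo (suc n)))

conv-zeroˡ : {f : Poly} (g : Poly) → (∀ i → f i ≡ 0) → ∀ n → (f *ₚ g) n ≡ 0
conv-zeroˡ g z n = sum-map-zero (λ i → cong (_* g (n ∸ i)) (z i)) (upTo (suc n))

conv-identityˡ : (g : Poly) → (oneₚ *ₚ g) ≈ₚ g
conv-identityˡ g zero    = trans (conv-zero oneₚ g) (*-identityˡ (g 0))
conv-identityˡ g (suc n) = begin
  (oneₚ *ₚ g) (suc n)                        ≡⟨ conv-suc oneₚ g n ⟩
  1 * g (suc n) + ((oneₚ ∘ suc) *ₚ g) n     ≡⟨ cong₂ _+_ (*-identityˡ (g (suc n))) (conv-zeroˡ g (λ _ → refl) n) ⟩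
  g (suc n) + 0                              ≡⟨ +-identityʳ (g (suc n)) ⟩
  g (suc n)                                  ∎

q-shift : (g : Poly) → (qₚ *ₚ g) ≈ₚ sh g
q-shift g zero    = conv-zero qₚ g
q-shift g (suc n) = begin
  (qₚ *ₚ g) (suc n)       ≡⟨ conv-suc qₚ g n ⟩
  ((qₚ ∘ suc) *ₚ g) n     ≡⟨ conv-congˡ g q∘suc≈1 n ⟩
  (oneₚ *ₚ g) n           ≡⟨ conv-identityˡ g n ⟩
  g n                     ∎
  where
  q∘suc≈1 : (qₚ ∘ suc) ≈ₚ oneₚ
  q∘suc≈1 zero    = refl
  q∘suc≈1 (suc _) = refl

qint-zero : ∀ i → qint 0 i ≡ 0
qint-zero i with suc i ≤? 0
... | yes ()
... | no _ = refl

qint-head : ∀ l → qint (suc l) 0 ≡ 1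
qint-head l with 1 ≤? suc l
... | yes _   = refl
... | no 1≰sl = contradiction (s≤s z≤n) 1≰sl

qint-tail : ∀ l → (qint (suc l) ∘ suc) ≈ₚ qint l
qint-tail l i with suc (suc i) ≤? suc l | suc i ≤? l
... | yes _     | yes _    = refl
... | no _      | no _     = refl
... | yes ssi≤sl | no si≰l = contradiction (≤-pred ssi≤sl) si≰l
... | no ssi≰sl | yes si≤l = contradiction (s≤s si≤l) ssi≰sl

qint-window : ∀ l (a : Poly) → (qint l *ₚ a) ≈ₚ window l a
qint-window zero    a n       = conv-zeroˡ a qint-zero n
qint-window (suc l) a zero    = trans (conv-zero (qint (suc l)) a) (cong (_* a 0) (qint-head l))
qint-window (suc l) a (suc n) = begin
  (qint (suc l) *ₚ a) (suc n)                                   ≡⟨ conv-suc (qint (suc l)) a n ⟩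
  qint (suc l) 0 * a (suc n) + ((qint (suc l) ∘ suc) *ₚ a) n     ≡⟨ cong₂ _+_ head tail ⟩
  a (suc n) + window l a n                                      ∎
  where
  head : qint (suc l) 0 * a (suc n) ≡ a (suc n)
  head = trans (cong (_* a (suc n)) (qint-head l)) (*-identityˡ (a (suc n)))
  tail : ((qint (suc l) ∘ suc) *ₚ a) n ≡ window l a n
  tail = trans (conv-congˡ a (qint-tail l) n) (qint-window l a n)

count : {A : Set} {P : Pred A 0ℓ} → Decidable P → List A → ℕ
count P? xs = length (filter P? xs)

module _ {A : Set} {P : Pred A 0ℓ} (P? : Decidable P) where

  count-++ : (xs ys : List A) → count P? (xs ++ ys) ≡ count P? xs + count P? ys
  count-++ xs ys = trans (cong length (filter-++ P? xs ys)) (length-++ (filter P? xs))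

  count-concatMap : {B : Set} (f : B → List A) (xs : List B) →
    count P? (concatMap f xs) ≡ sum (map (count P? ∘ f) xs)
  count-concatMap f []       = refl
  count-concatMap f (x ∷ xs) =
    trans (count-++ (f x) (concatMap f xs)) (cong (count P? (f x) +_) (count-concatMap f xs))

  count-map : {B : Set} (f : B → A) (xs : List B) → count P? (map f xs) ≡ count (P? ∘ f) xs
  count-map f []       = refl
  count-map f (x ∷ xs) with does (P? (f x))
  ... | true  = cong suc (count-map f xs)
  ... | false = count-map f xs

  count-none : (∀ x → ¬ P x) → (xs : List A) → count P? xs ≡ 0
  count-none ¬P []       = refl
  count-none ¬P (x ∷ xs) = trans (cong length (filter-reject P? (¬P x))) (count-none ¬P xs)

  filter-filter : {Q : Pred A 0ℓ} (Q? : Decidable Q) (xs : List A) →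
    filter Q? (filter P? xs) ≡ filter (P? ∩? Q?) xs
  filter-filter Q? []       = refl
  filter-filter Q? (x ∷ xs) with does (P? x)
  ... | false = filter-filter Q? xs
  ... | true with does (Q? x)
  ...   | false = filter-filter Q? xs
  ...   | true  = cong (x ∷_) (filter-filter Q? xs)

count-≐ : {A : Set} {P Q : Pred A 0ℓ} (P? : Decidable P) (Q? : Decidable Q) →
  P ≐ Q → (xs : List A) → count P? xs ≡ count Q? xs
count-≐ P? Q? P≐Q xs = cong length (filter-≐ P? Q? P≐Q xs)

fRec : List ℕ → Poly
fRec []      = oneₚ
fRec (l ∷ γ) = oneₚ +ₚ sh (window l (fRec γ))

Member : List ℕ → ℕ → Pred (List ℕ) 0ℓ
Member κ n = (_≼ κ) ∩ (λ γ → size γ ≡ n)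

member? : ∀ κ n → Decidable (Member κ n)
member? κ n = (_≼? κ) ∩? (λ γ → size γ ≟ n)

≼-∷ : ∀ {x y xs ys} → x ≤ y → xs ≼ ys → (x ∷ xs) ≼ (y ∷ ys)
≼-∷ x≤y xs≼ys zero    = x≤y
≼-∷ x≤y xs≼ys (suc i) = xs≼ys i

≼-head : ∀ {x y xs ys} → (x ∷ xs) ≼ (y ∷ ys) → x ≤ y
≼-head h = h zero

≼-tail : ∀ {x y xs ys} → (x ∷ xs) ≼ (y ∷ ys) → xs ≼ ys
≼-tail h i = h (suc i)

count-empty : ∀ κ n ys → count (member? κ n) ([] ∷ ys) ≡ oneₚ n + count (member? κ n) ys
count-empty κ zero    ys = cong length (filter-accept (member? κ 0) {[]} {ys} ((λ _ → z≤n) , refl))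
count-empty κ (suc n) ys = cong length (filter-reject (member? κ (suc n)) {[]} {ys} λ { (_ , ()) })

-- blockTerm l a n i = a (n ∸ (i + 1)) if i < l and i < n, and 0 otherwise:
-- the compositions of size n in K(l ∷ γ) with first part i + 1.
blockTerm : ℕ → Poly → ℕ → ℕ → ℕ
blockTerm (suc l) a (suc n) zero    = a n
blockTerm (suc l) a (suc n) (suc i) = blockTerm l a n i
blockTerm _       _ _       _       = 0

blockTerm-inside : ∀ {l n i} (a : Poly) → i < l → i < n → blockTerm l a n i ≡ a (n ∸ suc i)
blockTerm-inside {suc l} {suc n} {zero}  a _       _       = refl
blockTerm-inside {suc l} {suc n} {suc i} a (s≤s p) (s≤s q) = blockTerm-inside a p q

blockTerm-outside : ∀ l n i (a : Poly) → ¬ (i < l × i < n) → blockTerm l a n i ≡ 0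
blockTerm-outside zero    n       i       a _   = refl
blockTerm-outside (suc l) zero    i       a _   = refl
blockTerm-outside (suc l) (suc n) zero    a out = contradiction (s≤s z≤n , s≤s z≤n) out
blockTerm-outside (suc l) (suc n) (suc i) a out =
  blockTerm-outside l n i a λ { (p , q) → out (s≤s p , s≤s q) }

sum-blockTerm : ∀ l M (a : Poly) n → l ≤ M → sum (map (blockTerm l a n) (upTo M)) ≡ sh (window l a) n
sum-blockTerm zero    M       a zero    _ = sum-map-zero (λ _ → refl) (upTo M)
sum-blockTerm zero    M       a (suc n) _ = sum-map-zero (λ _ → refl) (upTo M)
sum-blockTerm (suc l) (suc M) a zero    _ = sum-map-zero (λ _ → refl) (upTo (suc M))
sum-blockTerm (suc l) (suc M) a (suc n) (s≤s l≤M) = begin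
  sum (map (blockTerm (suc l) a (suc n)) (upTo (suc M)))   ≡⟨ sum-upTo-suc _ M ⟩
  a n + sum (map (blockTerm l a n) (upTo M))               ≡⟨ cong (a n +_) (sum-blockTerm l M a n l≤M) ⟩
  a n + sh (window l a) n                                  ∎

member-∷ : ∀ {l γ n i} → i < l → i < n → Member (l ∷ γ) n ∘ (suc i ∷_) ≐ Member γ (n ∸ suc i)
member-∷ {l} {γ} {n} {i} i<l i<n = to , from
  where
  to : ∀ {x} → Member (l ∷ γ) n (suc i ∷ x) → Member γ (n ∸ suc i) x
  to {x} (x≼ , e) = ≼-tail x≼ , trans (sym (m+n∸m≡n (suc i) (size x))) (cong (_∸ suc i) e)
  from : ∀ {x} → Member γ (n ∸ suc i) x → Member (l ∷ γ) n (suc i ∷ x)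
  from (x≼ , e) = ≼-∷ i<l x≼ , trans (cong (suc i +_) e) (m+[n∸m]≡n i<n)

member-∷-bounds : ∀ {l γ n i x} → Member (l ∷ γ) n (suc i ∷ x) → i < l × i < n
member-∷-bounds {i = i} {x} (x≼ , e) = ≼-head x≼ , subst (suc i ≤_) e (m≤m+n (suc i) (size x))

count-block : ∀ l γ n i (xs : List (List ℕ)) (a : Poly) → (∀ s → count (member? γ s) xs ≡ a s) →
  count (member? (l ∷ γ) n) (map (suc i ∷_) xs) ≡ blockTerm l a n i
count-block l γ n i xs a counted with (i <? l) ×-dec (i <? n)
... | yes (i<l , i<n) = begin
  count (member? (l ∷ γ) n) (map (suc i ∷_) xs)       ≡⟨ count-map (member? (l ∷ γ) n) (suc i ∷_) xs ⟩
  count (member? (l ∷ γ) n ∘ (suc i ∷_)) xs          ≡⟨ count-≐ _ (member? γ (n ∸ suc i)) (member-∷ i<l i<n) xs ⟩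
  count (member? γ (n ∸ suc i)) xs                    ≡⟨ counted (n ∸ suc i) ⟩
  a (n ∸ suc i)                                       ≡⟨ blockTerm-inside a i<l i<n ⟨
  blockTerm l a n i                                   ∎
... | no out = begin
  count (member? (l ∷ γ) n) (map (suc i ∷_) xs)       ≡⟨ count-map (member? (l ∷ γ) n) (suc i ∷_) xs ⟩
  count (member? (l ∷ γ) n ∘ (suc i ∷_)) xs          ≡⟨ count-none _ (λ x m → out (member-∷-bounds m)) xs ⟩
  0                                                   ≡⟨ blockTerm-outside l n i a out ⟨
  blockTerm l a n i                                   ∎

count-boundedComps : ∀ κ M → maxPart κ ≤ M → ∀ n →
  count (member? κ n) (boundedComps (length κ) M) ≡ fRec κ n
count-boundedComps []      M _     zero    = refl
count-boundedComps []      M _     (suc n) = refl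
count-boundedComps (l ∷ γ) M bound n = begin
  count (member? (l ∷ γ) n) ([] ∷ concatMap block (map suc (upTo M)))
    ≡⟨ count-empty (l ∷ γ) n _ ⟩
  oneₚ n + count (member? (l ∷ γ) n) (concatMap block (map suc (upTo M)))
    ≡⟨ cong (oneₚ n +_) blocks ⟩
  oneₚ n + sh (window l (fRec γ)) n
    ∎
  where
  B = boundedComps (length γ) M
  block : ℕ → List (List ℕ)
  block k = map (k ∷_) B
  blocks : count (member? (l ∷ γ) n) (concatMap block (map suc (upTo M))) ≡ sh (window l (fRec γ)) n
  blocks = begin
    count (member? (l ∷ γ) n) (concatMap block (map suc (upTo M)))
      ≡⟨ count-concatMap (member? (l ∷ γ) n) block (map suc (upTo M)) ⟩
    sum (map (count (member? (l ∷ γ) n) ∘ block) (map suc (upTo M)))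
      ≡⟨ cong sum (map-∘ (upTo M)) ⟨
    sum (map (count (member? (l ∷ γ) n) ∘ block ∘ suc) (upTo M))
      ≡⟨ cong sum (map-cong (λ i → count-block l γ n i B (fRec γ)
                                      (count-boundedComps γ M (m⊔n≤o⇒n≤o l _ bound))) (upTo M)) ⟩
    sum (map (blockTerm l (fRec γ) n) (upTo M))
      ≡⟨ sum-blockTerm l M (fRec γ) n (m⊔n≤o⇒m≤o l _ bound) ⟩
    sh (window l (fRec γ)) n
      ∎

fK≈fRec : ∀ κ → fK κ ≈ₚ fRec κ
fK≈fRec κ n =
  trans (cong length (filter-filter (_≼? κ) (λ γ → size γ ≟ n) (boundedComps (length κ) (maxPart κ))))
        (count-boundedComps κ (maxPart κ) ≤-refl n)

recurrence : ∀ l γ → fK (l ∷ γ) ≈ₚ (oneₚ +ₚ (qₚ *ₚ (qint l *ₚ fK γ)))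
recurrence l γ n = begin
  fK (l ∷ γ) n                              ≡⟨ fK≈fRec (l ∷ γ) n ⟩
  oneₚ n + sh (window l (fRec γ)) n         ≡⟨ cong (oneₚ n +_) (sh-cong [l]fK≈window n) ⟨
  oneₚ n + sh (qint l *ₚ fK γ) n            ≡⟨ cong (oneₚ n +_) (q-shift (qint l *ₚ fK γ) n) ⟨
  oneₚ n + (qₚ *ₚ (qint l *ₚ fK γ)) n       ∎
  where
  [l]fK≈window : (qint l *ₚ fK γ) ≈ₚ window l (fRec γ)
  [l]fK≈window m = trans (conv-congʳ (qint l) (fK≈fRec γ) m) (qint-window l (fRec γ) m)

UnimodalSeq : Poly → Set
UnimodalSeq a = Σ ℕ λ m → (∀ i → i < m → a i ≤ a (suc i)) × (∀ i → m ≤ i → a (suc i) ≤ a i)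

UnimodalSeq-cong : {a b : Poly} → a ≈ₚ b → UnimodalSeq a → UnimodalSeq b
UnimodalSeq-cong e (m , rising , falling) =
  m , (λ i i<m → subst₂ _≤_ (e i) (e (suc i)) (rising i i<m))
    , (λ i m≤i → subst₂ _≤_ (e (suc i)) (e i) (falling i m≤i))

UnimodalSeq⇒Unimodal : {a : Poly} → UnimodalSeq a → ∀ r → Unimodal r a
UnimodalSeq⇒Unimodal (m , rising , falling) r with m ≤? r
... | yes m≤r = m , m≤r , rising , (λ i m≤i _ → falling i m≤i)
... | no  m≰r = r , ≤-refl , (λ i i<r → rising i (<-trans i<r (≰⇒> m≰r))) ,
                (λ i r≤i i<r → contradiction r≤i (<⇒≱ i<r))

module Peak {a : Poly} {m : ℕ}
            (rising : ∀ i → i < m → a i ≤ a (suc i))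
            (falling : ∀ i → m ≤ i → a (suc i) ≤ a i) where

  increasing : ∀ {i j} → i ≤′ j → j ≤ m → a i ≤ a j
  increasing ≤′-refl        _    = ≤-refl
  increasing (≤′-step i≤′j) j<m = ≤-trans (increasing i≤′j (<⇒≤ j<m)) (rising _ j<m)

  decreasing : ∀ {i j} → i ≤′ j → m ≤ i → a j ≤ a i
  decreasing ≤′-refl        _   = ≤-refl
  decreasing (≤′-step i≤′j) m≤i = ≤-trans (falling _ (≤-trans m≤i (≤′⇒≤ i≤′j))) (decreasing i≤′j m≤i)

  no-valley : ∀ {i j k} → i ≤ j → j ≤ k → a i ≤ a j ⊎ a k ≤ a j
  no-valley i≤j j≤k with _ ≤? m
  ... | yes j≤m = inj₁ (increasing (≤⇒≤′ i≤j) j≤m)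
  ... | no  j≰m = inj₂ (decreasing (≤⇒≤′ j≤k) (<⇒≤ (≰⇒> j≰m)))

  drop-persists : ∀ {y x} → y ≤ x → a x < a y → ∀ d → a (x + d) ≤ a (y + d)
  drop-persists {y} {x} y≤x ax<ay d with no-valley y≤x (m≤m+n x d)
  ... | inj₁ ay≤ax = contradiction ay≤ax (<⇒≱ ax<ay)
  ... | inj₂ ax+d≤ax with no-valley (m≤m+n y d) (+-monoˡ-≤ d y≤x)
  ...   | inj₁ ay≤ay+d = ≤-trans ax+d≤ax (≤-trans (<⇒≤ ax<ay) ay≤ay+d)
  ...   | inj₂ ax+d≤ay+d = ax+d≤ay+d

shiftBy : ℕ → Poly → Poly
shiftBy zero    a = a
shiftBy (suc l) a = sh (shiftBy l a)

shiftBy-below : ∀ l (a : Poly) {k} → k < l → shiftBy l a k ≡ 0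
shiftBy-below (suc l) a {zero}  _         = refl
shiftBy-below (suc l) a {suc k} (s≤s k<l) = shiftBy-below l a k<l

shiftBy-offset : ∀ l (a : Poly) j → shiftBy l a (j + l) ≡ a j
shiftBy-offset zero    a j = cong a (+-identityʳ j)
shiftBy-offset (suc l) a j = trans (cong (shiftBy (suc l) a) (+-suc j l)) (shiftBy-offset l a j)

offset : ∀ {l n} → l ≤ n → ∃[ j ] n ≡ j + l
offset {l} {n} l≤n = n ∸ l , sym (m∸n+n≡m l≤n)

-- Telescoping: window l a n − window l a (n − 1) = a n − a (n − l).
window-telescope : ∀ l (a : Poly) n → window l a n + shiftBy l a n ≡ a n + sh (window l a) n
window-telescope zero    a zero    = sym (+-identityʳ (a 0))
window-telescope zero    a (suc n) = sym (+-identityʳ (a (suc n)))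
window-telescope (suc l) a zero    = +-identityʳ (a 0 + 0)
window-telescope (suc l) a (suc n) =
  trans (+-assoc (a (suc n)) _ _) (cong (a (suc n) +_) (window-telescope l a n))

window-rises : ∀ l (a : Poly) k → shiftBy l a (suc k) ≤ a (suc k) → window l a k ≤ window l a (suc k)
window-rises l a k s≤a = +-cancelʳ-≤ (a (suc k)) _ _
  (≤-trans (≤-reflexive (trans (+-comm (window l a k) (a (suc k))) (sym (window-telescope l a (suc k)))))
           (+-monoʳ-≤ (window l a (suc k)) s≤a))

window-falls : ∀ l (a : Poly) k → a (suc k) ≤ shiftBy l a (suc k) → window l a (suc k) ≤ window l a k
window-falls l a k a≤s = +-cancelʳ-≤ (shiftBy l a (suc k)) _ _
  (≤-trans (≤-reflexive (window-telescope l a (suc k)))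
           (≤-trans (+-monoˡ-≤ (window l a k) a≤s) (≤-reflexive (+-comm (shiftBy l a (suc k)) (window l a k)))))

module WindowDifferences (l : ℕ) {a : Poly} {m : ℕ}
         (rising : ∀ i → i < m → a i ≤ a (suc i))
         (falling : ∀ i → m ≤ i → a (suc i) ≤ a i) where

  open Peak rising falling

  falls-late : ∀ n → m + l ≤ n → a n ≤ shiftBy l a n
  falls-late n m+l≤n with offset (≤-trans (m≤n+m l m) m+l≤n)
  ... | j , refl = subst (a (j + l) ≤_) (sym (shiftBy-offset l a j))
                         (decreasing (≤⇒≤′ (m≤m+n j l)) (+-cancelʳ-≤ l m j m+l≤n))

  falls-persist : ∀ n → a n < shiftBy l a n → ∀ d → a (n + d) ≤ shiftBy l a (n + d)
  falls-persist n a<s d with l ≤? n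
  ... | no l≰n = contradiction (subst (a n <_) (shiftBy-below l a (≰⇒> l≰n)) a<s) λ ()
  ... | yes l≤n with offset l≤n
  ...   | j , refl = subst (a (j + l + d) ≤_) (sym shifted)
                           (drop-persists (m≤m+n j l) (subst (a (j + l) <_) (shiftBy-offset l a j) a<s) d)
    where
    shifted : shiftBy l a (j + l + d) ≡ a (j + d)
    shifted = trans (cong (shiftBy l a) (xy∙z≈xz∙y j l d)) (shiftBy-offset l a (j + d))

firstFailure : (P : ℕ → Set) → (∀ k → Dec (P k)) → ∀ n →
  Σ ℕ λ M → (∀ k → k < M → P k) × (M ≡ n ⊎ ¬ P M)
firstFailure P P? zero = 0 , (λ _ ()) , inj₁ refl
firstFailure P P? (suc n) with firstFailure P P? n
... | M , below , inj₂ ¬PM = M , below , inj₂ ¬PM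
... | M , below , inj₁ refl with P? M
...   | no ¬PM = M , below , inj₂ ¬PM
...   | yes PM = suc M , below′ , inj₁ refl
  where
  below′ : ∀ k → k < suc M → P k
  below′ k k<sM with m<1+n⇒m<n∨m≡n k<sM
  ... | inj₁ k<M  = below k k<M
  ... | inj₂ refl = PM

-- [l]·a is unimodal whenever a is: it rises up to the first point where
-- a n − a (n − l) becomes negative (or up to m + l), and falls afterwards.
window-unimodal : ∀ l {a : Poly} → UnimodalSeq a → UnimodalSeq (window l a)
window-unimodal l {a} (m , rising , falling)
  with firstFailure (λ k → shiftBy l a (suc k) ≤ a (suc k)) (λ k → shiftBy l a (suc k) ≤? a (suc k)) (m + l)
... | M , rises , stop = M , (λ k k<M → window-rises l a k (rises k k<M)) , falls-from stop
  where
  open WindowDifferences l rising falling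
  falls-from : M ≡ m + l ⊎ ¬ (shiftBy l a (suc M) ≤ a (suc M)) →
               ∀ k → M ≤ k → window l a (suc k) ≤ window l a k
  falls-from (inj₁ refl) k M≤k = window-falls l a k (falls-late (suc k) (≤-trans M≤k (n≤1+n k)))
  falls-from (inj₂ ¬rise) k M≤k = window-falls l a k
    (subst (λ x → a (suc x) ≤ shiftBy l a (suc x)) (m+[n∸m]≡n M≤k)
           (falls-persist (suc M) (≰⇒> ¬rise) (k ∸ M)))

one-plus-q-unimodal : {b : Poly} → 1 ≤ b 0 → UnimodalSeq b → UnimodalSeq (oneₚ +ₚ sh b)
one-plus-q-unimodal {b} 1≤b₀ (m , rising , falling) = suc m , rising′ , falling′
  where
  rising′ : ∀ i → i < suc m → (oneₚ +ₚ sh b) i ≤ (oneₚ +ₚ sh b) (suc i)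
  rising′ zero    _         = 1≤b₀
  rising′ (suc i) (s≤s i<m) = rising i i<m
  falling′ : ∀ i → suc m ≤ i → (oneₚ +ₚ sh b) (suc i) ≤ (oneₚ +ₚ sh b) i
  falling′ (suc i) (s≤s m≤i) = falling i m≤i

fRec-zero : ∀ κ → fRec κ 0 ≡ 1
fRec-zero []      = refl
fRec-zero (_ ∷ _) = refl

fRec-unimodal : ∀ κ → IsComposition κ → UnimodalSeq (fRec κ)
fRec-unimodal []            _            = 0 , (λ _ ()) , (λ _ _ → z≤n)
fRec-unimodal (zero ∷ γ)    (() ∷ _)
fRec-unimodal (suc l ∷ γ)   (_ ∷ parts) =
  one-plus-q-unimodal 1≤window₀ (window-unimodal (suc l) (fRec-unimodal γ parts))
  where
  1≤window₀ : 1 ≤ window (suc l) (fRec γ) 0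
  1≤window₀ = ≤-reflexive (sym (trans (+-identityʳ (fRec γ 0)) (fRec-zero γ)))

theorem3p3 :
    (∀ (l : ℕ) (γ : List ℕ) → IsComposition (l ∷ γ) →
       fK (l ∷ γ) ≈ₚ (oneₚ +ₚ (qₚ *ₚ (qint l *ₚ fK γ))))
    × (∀ (κ : List ℕ) → IsComposition κ → Unimodal (size κ) (fK κ))
theorem3p3 = (λ l γ _ → recurrence l γ) , unimodal
  where
  unimodal : ∀ κ → IsComposition κ → Unimodal (size κ) (fK κ)
  unimodal κ parts =
    UnimodalSeq⇒Unimodal (UnimodalSeq-cong (λ n → sym (fK≈fRec κ n)) (fRec-unimodal κ parts)) (size κ)
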